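{- Let $\phi$ be a Gallai coloring of $K_n$ with colors in $\{\text{red},\text{green},\text{blue}\}$. If $\phi'$ is a Gallai coloring of $K_{n+1}$ (with colors in $\{\text{red},\text{green},\text{blue}\}$) whose restriction to $E(K_n)$ is $\phi$, then $w(\phi')\le 2w(\phi)+1$.
   Context: A Gallai coloring of $K_m$ is a coloring $E(K_m)\to\{\text{red},\text{green},\text{blue}\}$ with no rainbow triangle (triangle whose three edges have three distinct colors). For a Gallai coloring $\psi$ of $K_m$, regard $K_{m+1}$ as $K_m$ plus a new vertex $u$; $w(\psi)$ is the number of colorings of the edges from $u$ to $V(K_m)$ with colors in $\{\text{red},\text{green},\text{blue}\}$ such that the resulting coloring of $E(K_{m+1})$ is Gallai. -}

module Defs where

open import Data.Nat using (ℕ; zero; suc)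
open import Data.Fin using (Fin; zero; suc)
open import Data.Fin.Properties using (_≟_)
open import Data.Vec using (Vec; []; _∷_; lookup)
open import Data.List using (List; []; _∷_; map; concatMap; length; filter; allFin)
open import Data.Product using (_×_; _,_)
open import Relation.Binary.PropositionalEquality using (_≡_)
open import Relation.Nullary using (¬_; Dec; yes; no)
open import Relation.Nullary.Decidable using (_×-dec_; ¬?)
open import Data.Fin.Properties using (all?)

data Color : Set where
  red green blue : Color

_≟c_ : (a b : Color) → Dec (a ≡ b)
red ≟c red = yes _≡_.refl
red ≟c green = no λ ()
red ≟c blue = no λ ()
green ≟c red = no λ ()
green ≟c green = yes _≡_.refl
green ≟c blue = no λ ()
blue ≟c red = no λ ()
blue ≟c green = no λ ()
blue ≟c blue = yes _≡_.refl

-- An edge coloring of K_m: the color of edge {i,j} is c i j.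
-- The value on the diagonal (i = j) is irrelevant; symmetry is required separately.
Coloring : ℕ → Set
Coloring m = Fin m → Fin m → Color

Symmetric : ∀ {m} → Coloring m → Set
Symmetric c = ∀ i j → c i j ≡ c j i

Rainbow : Color → Color → Color → Set
Rainbow a b d = ¬ (a ≡ b) × ¬ (b ≡ d) × ¬ (a ≡ d)

NoRainbow : ∀ {m} → Coloring m → Set
NoRainbow c = ∀ i j k → ¬ (i ≡ j) → ¬ (j ≡ k) → ¬ (i ≡ k) →
  ¬ Rainbow (c i j) (c j k) (c i k)

IsGallai : ∀ {m} → Coloring m → Set
IsGallai c = Symmetric c × NoRainbow c

-- K_{m+1} = K_m plus a new vertex u; we take u = zero and the old vertex i is suc i.
-- extend c f colors edge {u, i} by f i.
extend : ∀ {m} → Coloring m → (Fin m → Color) → Coloring (suc m)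
extend c f zero zero = red
extend c f zero (suc j) = f j
extend c f (suc i) zero = f i
extend c f (suc i) (suc j) = c i j

restrict : ∀ {m} → Coloring (suc m) → Coloring m
restrict c i j = c (suc i) (suc j)

rainbow? : ∀ a b d → Dec (Rainbow a b d)
rainbow? a b d = ¬? (a ≟c b) ×-dec ¬? (b ≟c d) ×-dec ¬? (a ≟c d)

triangleOK? : ∀ {m} (c : Coloring m) (i j k : Fin m) →
  Dec (¬ (i ≡ j) → ¬ (j ≡ k) → ¬ (i ≡ k) → ¬ Rainbow (c i j) (c j k) (c i k))
triangleOK? c i j k with i ≟ j | j ≟ k | i ≟ k | rainbow? (c i j) (c j k) (c i k)
... | yes p | _ | _ | _ = yes λ ne _ _ _ → ne p
... | no _ | yes q | _ | _ = yes λ _ ne _ _ → ne q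
... | no _ | no _ | yes r | _ = yes λ _ _ ne _ → ne r
... | no _ | no _ | no _ | no nr = yes λ _ _ _ → nr
... | no p | no q | no r | yes rb = no λ h → h p q r rb

noRainbow? : ∀ {m} (c : Coloring m) → Dec (NoRainbow c)
noRainbow? c = all? λ i → all? λ j → all? λ k → triangleOK? c i j k

symmetric? : ∀ {m} (c : Coloring m) → Dec (Symmetric c)
symmetric? c = all? λ i → all? λ j → c i j ≟c c j i

isGallai? : ∀ {m} (c : Coloring m) → Dec (IsGallai c)
isGallai? c = symmetric? c ×-dec noRainbow? c

allVecs : (m : ℕ) → List (Vec Color m)
allVecs zero = [] ∷ []
allVecs (suc m) = concatMap (λ v → (red ∷ v) ∷ (green ∷ v) ∷ (blue ∷ v) ∷ []) (allVecs m)

-- w(ψ): the number of colorings f of the edges from the new vertex u to V(K_m)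
-- such that the resulting coloring of K_{m+1} is Gallai.
w : ∀ {m} → Coloring m → ℕ
w {m} ψ = length (filter (λ v → isGallai? (extend ψ (lookup v))) (allVecs m))

-- Let x be the vertex of K_{n+1} outside K_n, and group the extensions of φ' by their
-- colours v on the edges to K_n.  Deleting x from a Gallai extension of φ' leaves a Gallai
-- extension v of φ, so each v contributes nothing unless v extends φ.  If all three colours
-- of the edge ux work, then v agrees with the colours of the edges at x: where they differ,
-- the triangle u x i leaves a colour for ux that would make it rainbow.  Hence each v
-- contributes at most 2, except the single v equal to the link of x, which contributes at
-- most 3.
module Submission where

open import Defs
open import Data.Nat using (ℕ; zero; suc; _+_; _*_; _≤_; z≤n; s≤s; s≤s⁻¹)
open import Data.Nat.Properties using (≤-reflexive; ≤-trans; +-mono-≤; +-monoʳ-≤; *-zeroʳ; module ≤-Reasoning)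
open import Data.Nat.Tactic.RingSolver using (solve-∀)
open import Data.Fin using (Fin; zero; suc; punchIn)
open import Data.Fin.Properties using (punchIn-injective)
open import Data.Vec using (Vec; []; _∷_; lookup; tabulate)
open import Data.Vec.Properties using (≡-dec; ∷-injectiveˡ; ∷-injectiveʳ; tabulate∘lookup; tabulate-cong)
open import Data.List using (List; []; _∷_; _++_; map; concatMap; length; filter)
open import Data.Nat.ListAction using (sum)
open import Data.List.Properties using (filter-++; length-++; length-filter; filter-none; filter-notAll)
open import Data.List.Relation.Unary.All as All using (All; []; _∷_)
open import Data.List.Relation.Unary.All.Properties.Core using (¬All⇒Any¬)
open import Data.List.Relation.Unary.AllPairs using ([]; _∷_)
open import Data.List.Relation.Unary.Unique.Propositional using (Unique)
open import Data.Product using (Σ; _×_; _,_; proj₂)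
open import Function using (_∘_)
open import Function.Definitions using (Injective)
open import Relation.Binary.Definitions using (DecidableEquality)
open import Relation.Binary.PropositionalEquality using (_≡_; _≢_; refl; sym; trans; cong; cong₂)
open import Relation.Nullary using (¬_; Dec; yes; no; contradiction)
open import Relation.Unary using (Pred; Decidable)
open import Level using (0ℓ)

indicator : ∀ {a} {A : Set a} → Dec A → ℕ
indicator (yes _) = 1
indicator (no _) = 0

module _ {a p} {A : Set a} {P : Pred A p} (P? : Decidable P) where

  count : List A → ℕ
  count = length ∘ filter P?

  count-∷ : ∀ x xs → count (x ∷ xs) ≡ indicator (P? x) + count xs
  count-∷ x xs with P? x
  ... | yes _ = refl
  ... | no _ = refl

  count-++ : ∀ xs ys → count (xs ++ ys) ≡ count xs + count ys
  count-++ xs ys = trans (cong length (filter-++ P? xs ys)) (length-++ (filter P? xs))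

  sum-map-indicator : ∀ xs → sum (map (indicator ∘ P?) xs) ≡ count xs
  sum-map-indicator [] = refl
  sum-map-indicator (x ∷ xs) = trans (cong (indicator (P? x) +_) (sum-map-indicator xs)) (sym (count-∷ x xs))

  count-concatMap-≤ : ∀ {b} {B : Set b} (T : B → List A) (f : B → ℕ) →
    (∀ y → count (T y) ≤ f y) → ∀ ys → count (concatMap T ys) ≤ sum (map f ys)
  count-concatMap-≤ T f bound [] = z≤n
  count-concatMap-≤ T f bound (y ∷ ys) = begin
    count (T y ++ concatMap T ys)
      ≡⟨ count-++ (T y) (concatMap T ys) ⟩
    count (T y) + count (concatMap T ys)
      ≤⟨ +-mono-≤ (bound y) (count-concatMap-≤ T f bound ys) ⟩
    f y + sum (map f ys) ∎
    where open ≤-Reasoning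

sum-map-linear : ∀ {a} {A : Set a} (k : ℕ) (f g : A → ℕ) xs →
  sum (map (λ x → k * f x + g x) xs) ≡ k * sum (map f xs) + sum (map g xs)
sum-map-linear k f g [] = sym (cong (_+ 0) (*-zeroʳ k))
sum-map-linear k f g (x ∷ xs) rewrite sum-map-linear k f g xs = regroup k (f x) (g x) (sum (map f xs)) (sum (map g xs))
  where
  regroup : ∀ k p q r s → k * p + q + (k * r + s) ≡ k * (p + r) + (q + s)
  regroup = solve-∀

count-≡-≤1 : ∀ {a} {A : Set a} (_≟_ : DecidableEquality A) {xs : List A} →
  Unique xs → ∀ y → count (_≟ y) xs ≤ 1
count-≡-≤1 _≟_ [] y = z≤n
count-≡-≤1 _≟_ {x ∷ xs} (x∉xs ∷ unique) y with x ≟ y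
... | yes refl = s≤s (≤-reflexive (cong length (filter-none (_≟ x) (All.map (_∘ sym) x∉xs))))
... | no _ = count-≡-≤1 _≟_ unique y

_≟v_ : ∀ {m} → DecidableEquality (Vec Color m)
_≟v_ = ≡-dec _≟c_

consColors : ∀ {m} → Vec Color m → List (Vec Color (suc m))
consColors v = (red ∷ v) ∷ (green ∷ v) ∷ (blue ∷ v) ∷ []

module _ {m ℓ} {P : Pred (Vec Color (suc m)) ℓ} {v : Vec Color m} where

  All-consColors⁺ : (∀ c → P (c ∷ v)) → All P (consColors v)
  All-consColors⁺ p = p red ∷ p green ∷ p blue ∷ []

  All-consColors⁻ : All P (consColors v) → ∀ c → P (c ∷ v)
  All-consColors⁻ (p ∷ _) red = p
  All-consColors⁻ (_ ∷ p ∷ _) green = p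
  All-consColors⁻ (_ ∷ _ ∷ p ∷ _) blue = p

consColors-unique : ∀ {m} (v : Vec Color m) → Unique (consColors v)
consColors-unique v = (∷-≢ (λ ()) ∷ ∷-≢ (λ ()) ∷ []) ∷ (∷-≢ (λ ()) ∷ []) ∷ [] ∷ []
  where
  ∷-≢ : ∀ {a b} → a ≢ b → a ∷ v ≢ b ∷ v
  ∷-≢ a≢b = a≢b ∘ ∷-injectiveˡ

count-≡-allVecs-≤1 : ∀ m (x : Vec Color m) → count (_≟v x) (allVecs m) ≤ 1
count-≡-allVecs-≤1 zero [] = length-filter (_≟v []) (allVecs zero)
count-≡-allVecs-≤1 (suc m) (c ∷ x) = begin
  count (_≟v (c ∷ x)) (concatMap consColors (allVecs m))
    ≤⟨ count-concatMap-≤ (_≟v (c ∷ x)) consColors (indicator ∘ (_≟v x)) atMostOneHead (allVecs m) ⟩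
  sum (map (indicator ∘ (_≟v x)) (allVecs m))
    ≡⟨ sum-map-indicator (_≟v x) (allVecs m) ⟩
  count (_≟v x) (allVecs m)
    ≤⟨ count-≡-allVecs-≤1 m x ⟩
  1 ∎
  where
  open ≤-Reasoning
  atMostOneHead : ∀ v → count (_≟v (c ∷ x)) (consColors v) ≤ indicator (v ≟v x)
  atMostOneHead v = bound (v ≟v x)
    where
    bound : (v≟x : Dec (v ≡ x)) → count (_≟v (c ∷ x)) (consColors v) ≤ indicator v≟x
    bound (yes refl) = count-≡-≤1 _≟v_ (consColors-unique v) (c ∷ v)
    bound (no v≢x) = ≤-reflexive (cong length (filter-none (_≟v (c ∷ x)) (All-consColors⁺ λ _ → v≢x ∘ ∷-injectiveʳ)))

NoRainbow-pullback : ∀ {m k} (c : Coloring k) (ι : Fin m → Fin k) → Injective _≡_ _≡_ ι →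
  NoRainbow c → NoRainbow (λ i j → c (ι i) (ι j))
NoRainbow-pullback c ι ι-inj noRainbow i j k i≢j j≢k i≢k =
  noRainbow (ι i) (ι j) (ι k) (i≢j ∘ ι-inj) (j≢k ∘ ι-inj) (i≢k ∘ ι-inj)

NoRainbow-offDiagonal-cong : ∀ {m} {c d : Coloring m} → (∀ i j → i ≢ j → c i j ≡ d i j) →
  NoRainbow c → NoRainbow d
NoRainbow-offDiagonal-cong c≈d noRainbow i j k i≢j j≢k i≢k
  rewrite sym (c≈d i j i≢j) | sym (c≈d j k j≢k) | sym (c≈d i k i≢k) = noRainbow i j k i≢j j≢k i≢k

extend-symmetric : ∀ {m} {c : Coloring m} → Symmetric c → ∀ f → Symmetric (extend c f)
extend-symmetric c-sym f zero zero = refl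
extend-symmetric c-sym f zero (suc j) = refl
extend-symmetric c-sym f (suc i) zero = refl
extend-symmetric c-sym f (suc i) (suc j) = c-sym i j

-- punchIn (suc zero) skips vertex suc zero, the vertex of K_{n+1} outside K_n.
module _ {n} {φ : Coloring n} {φ' : Coloring (suc n)}
         (agree : ∀ i j → i ≢ j → restrict φ' i j ≡ φ i j) where

  extend-punchIn : ∀ f a b → a ≢ b →
    extend φ' f (punchIn (suc zero) a) (punchIn (suc zero) b) ≡ extend φ (f ∘ suc) a b
  extend-punchIn f zero zero a≢b = refl
  extend-punchIn f zero (suc b) a≢b = refl
  extend-punchIn f (suc a) zero a≢b = refl
  extend-punchIn f (suc a) (suc b) a≢b = agree a b (a≢b ∘ cong suc)

  IsGallai-extend-deleteVertex : Symmetric φ → ∀ f → IsGallai (extend φ' f) → IsGallai (extend φ (f ∘ suc))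
  IsGallai-extend-deleteVertex φ-sym f (_ , noRainbow) =
    extend-symmetric φ-sym (f ∘ suc) ,
    NoRainbow-offDiagonal-cong (extend-punchIn f)
      (NoRainbow-pullback (extend φ' f) (punchIn (suc zero)) (punchIn-injective (suc zero) _ _) noRainbow)

otherColor : (a b : Color) → Σ Color λ c → c ≢ a × c ≢ b
otherColor red red = green , (λ ()) , (λ ())
otherColor red green = blue , (λ ()) , (λ ())
otherColor red blue = green , (λ ()) , (λ ())
otherColor green red = blue , (λ ()) , (λ ())
otherColor green green = red , (λ ()) , (λ ())
otherColor green blue = red , (λ ()) , (λ ())
otherColor blue red = green , (λ ()) , (λ ())
otherColor blue green = red , (λ ()) , (λ ())
otherColor blue blue = red , (λ ()) , (λ ())

linkColors : ∀ {n} → Coloring (suc n) → Vec Color n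
linkColors φ' = tabulate (φ' zero ∘ suc)

everyColor-NoRainbow⇒≡linkColors : ∀ {n} (φ' : Coloring (suc n)) (v : Vec Color n) →
  (∀ c → NoRainbow (extend φ' (lookup (c ∷ v)))) → v ≡ linkColors φ'
everyColor-NoRainbow⇒≡linkColors φ' v noRainbow = trans (sym (tabulate∘lookup v)) (tabulate-cong agree)
  where
  agree : ∀ i → lookup v i ≡ φ' zero (suc i)
  agree i with lookup v i ≟c φ' zero (suc i)
  ... | yes eq = eq
  ... | no v≢φ' with otherColor (φ' zero (suc i)) (lookup v i)
  ...   | c , c≢φ' , c≢v =
    contradiction (c≢φ' , v≢φ' ∘ sym , c≢v) (noRainbow c zero (suc zero) (suc (suc i)) (λ ()) (λ ()) (λ ()))

GallaiExtension : ∀ {m} → Coloring m → Pred (Vec Color m) 0ℓ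
GallaiExtension ψ v = IsGallai (extend ψ (lookup v))

gallaiExtension? : ∀ {m} (ψ : Coloring m) → Decidable (GallaiExtension ψ)
gallaiExtension? ψ v = isGallai? (extend ψ (lookup v))

count-consColors-≤ : ∀ {n} {φ : Coloring n} {φ' : Coloring (suc n)} → Symmetric φ →
  (∀ i j → i ≢ j → restrict φ' i j ≡ φ i j) → ∀ v →
  count (gallaiExtension? φ') (consColors v)
    ≤ 2 * indicator (gallaiExtension? φ v) + indicator (v ≟v linkColors φ')
count-consColors-≤ {φ = φ} {φ'} φ-sym agree v = bound (gallaiExtension? φ v) (v ≟v linkColors φ')
  where
  notEveryColor : v ≢ linkColors φ' → ¬ All (GallaiExtension φ') (consColors v)
  notEveryColor v≢link =
    v≢link ∘ everyColor-NoRainbow⇒≡linkColors φ' v ∘ λ gallai c → proj₂ (All-consColors⁻ gallai c)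

  bound : (g : Dec (GallaiExtension φ v)) (l : Dec (v ≡ linkColors φ')) →
    count (gallaiExtension? φ') (consColors v) ≤ 2 * indicator g + indicator l
  bound (no ¬gallai) _ = ≤-trans (≤-reflexive (cong length (filter-none (gallaiExtension? φ')
    (All-consColors⁺ λ c → ¬gallai ∘ IsGallai-extend-deleteVertex agree φ-sym (lookup (c ∷ v)))))) z≤n
  bound (yes _) (yes _) = length-filter (gallaiExtension? φ') (consColors v)
  bound (yes _) (no v≢link) = s≤s⁻¹ (filter-notAll (gallaiExtension? φ') (consColors v)
    (¬All⇒Any¬ (gallaiExtension? φ') (consColors v) (notEveryColor v≢link)))

lemma2p2 : (n : ℕ) (φ : Coloring n) (φ' : Coloring (suc n)) →
    IsGallai φ → IsGallai φ' →
    ((i j : Fin n) → ¬ (i ≡ j) → restrict φ' i j ≡ φ i j) →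
    w φ' ≤ 2 * w φ + 1
lemma2p2 n φ φ' (φ-sym , _) _ agree = begin
  w φ'
    ≤⟨ count-concatMap-≤ (gallaiExtension? φ') consColors bound (count-consColors-≤ φ-sym agree) (allVecs n) ⟩
  sum (map bound (allVecs n))
    ≡⟨ sum-map-linear 2 (indicator ∘ gallaiExtension? φ) (indicator ∘ (_≟v linkColors φ')) (allVecs n) ⟩
  2 * sum (map (indicator ∘ gallaiExtension? φ) (allVecs n)) + sum (map (indicator ∘ (_≟v linkColors φ')) (allVecs n))
    ≡⟨ cong₂ (λ a b → 2 * a + b) (sum-map-indicator (gallaiExtension? φ) (allVecs n))
                                 (sum-map-indicator (_≟v linkColors φ') (allVecs n)) ⟩
  2 * w φ + count (_≟v linkColors φ') (allVecs n)
    ≤⟨ +-monoʳ-≤ (2 * w φ) (count-≡-allVecs-≤1 n (linkColors φ')) ⟩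
  2 * w φ + 1 ∎
  where
  open ≤-Reasoning
  bound : Vec Color n → ℕ
  bound v = 2 * indicator (gallaiExtension? φ v) + indicator (v ≟v linkColors φ')
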